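{- As $n\to\infty$, the expected local dimension of a poset chosen uniformly at random from the set of all partial orders on the labelled ground set $[n]$ is at least \[\left(\frac14-o(1)\right)\frac{n}{\log n}.\]
   Context: Logarithms are base 2. For a poset $P=(X,\le)$, a partial linear extension is a linear order $L=(Y,\le_L)$ with $Y\subseteq X$ such that $x\le y$ implies $x\le_L y$ for $x,y\in Y$. A local realiser of $P$ is a set $\mathcal{L}$ of partial linear extensions such that for every ordered pair $(x,y)$ with $x\not\ge y$ some $L\in\mathcal{L}$ contains both $x,y$ and has $x\le_L y$. The multiplicity $\mu_{\mathcal{L}}(x)$ is the number of members of $\mathcal{L}$ whose ground set contains $x$; the local dimension $\operatorname{ldim}(P)$ is the minimum over local realisers $\mathcal{L}$ of $\max_{x\in X}\mu_{\mathcal{L}}(x)$. -}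

module Defs where

open import Data.Nat using (ℕ; zero; suc; _≤_)
open import Data.Bool using (Bool; true; false; _≟_)
open import Data.Fin using (Fin) renaming (zero to fz; suc to fs; _≟_ to _≟F_)
open import Data.Fin.Properties using (all?)
open import Data.List using (List; []; _∷_; _++_; map; concatMap; filter; length)
open import Data.Nat.ListAction using (sum)
open import Data.List.Relation.Unary.Unique.Propositional using (Unique)
open import Data.List.Membership.Propositional using (_∈_)
import Data.List.Membership.DecPropositional as DecMem
open import Data.Product using (Σ; ∃; ∃-syntax; _×_; _,_)
open import Relation.Binary.PropositionalEquality using (_≡_)
open import Relation.Nullary using (¬_; Dec; yes; no)
open import Relation.Nullary.Decidable using (_×-dec_; _→-dec_)

-- A binary relation on the labelled ground set [n] = Fin n, as a Boolean
-- matrix: x ≤ y  iff  R x y ≡ true.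
Rel : ℕ → Set
Rel n = Fin n → Fin n → Bool

_≤[_]_ : ∀ {n} → Fin n → Rel n → Fin n → Set
x ≤[ R ] y = R x y ≡ true

IsPartialOrder : ∀ {n} → Rel n → Set
IsPartialOrder {n} R =
  (∀ x → x ≤[ R ] x) ×
  (∀ x y → x ≤[ R ] y → y ≤[ R ] x → x ≡ y) ×
  (∀ x y z → x ≤[ R ] y → y ≤[ R ] z → x ≤[ R ] z)

isPartialOrder? : ∀ {n} (R : Rel n) → Dec (IsPartialOrder R)
isPartialOrder? R =
  all? (λ x → R x x ≟ true) ×-dec
  (all? λ x → all? λ y → (R x y ≟ true) →-dec ((R y x ≟ true) →-dec (x ≟F y))) ×-dec
  (all? λ x → all? λ y → all? λ z →
     (R x y ≟ true) →-dec ((R y z ≟ true) →-dec (R x z ≟ true)))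

consF : ∀ {A : Set} {m} → A → (Fin m → A) → Fin (suc m) → A
consF a g fz = a
consF a g (fs i) = g i

allFuns : ∀ {A : Set} → List A → (m : ℕ) → List (Fin m → A)
allFuns as zero = (λ ()) ∷ []
allFuns as (suc m) = concatMap (λ a → map (consF a) (allFuns as m)) as

allRels : (n : ℕ) → List (Rel n)
allRels n = allFuns (allFuns (false ∷ true ∷ []) n) n

allPosets : (n : ℕ) → List (Rel n)
allPosets n = filter isPartialOrder? (allRels n)

numPosets : ℕ → ℕ
numPosets n = length (allPosets n)

sumOverPosets : (n : ℕ) → (Rel n → ℕ) → ℕ
sumOverPosets n f = sum (map f (allPosets n))

-- A linear order on a subset Y of Fin n is represented by a duplicate-free
-- list enumerating Y from bottom to top.  x ≤_L y iff x occurs in L no later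
-- than y.
Before : ∀ {n} → List (Fin n) → Fin n → Fin n → Set
Before {n} L x y = ∃[ pre ] ∃[ suf ] (L ≡ pre ++ (x ∷ suf)) × (y ∈ (x ∷ suf))

IsPartialLinearExtension : ∀ {n} → Rel n → List (Fin n) → Set
IsPartialLinearExtension R L =
  Unique L × (∀ x y → x ∈ L → y ∈ L → x ≤[ R ] y → Before L x y)

IsLocalRealiser : ∀ {n} → Rel n → List (List (Fin n)) → Set
IsLocalRealiser {n} R 𝓛 =
  (∀ L → L ∈ 𝓛 → IsPartialLinearExtension R L) ×
  (∀ x y → ¬ (y ≤[ R ] x) →
     ∃[ L ] (L ∈ 𝓛) × (x ∈ L) × (y ∈ L) × Before L x y)

multiplicity : ∀ {n} → List (List (Fin n)) → Fin n → ℕ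
multiplicity {n} 𝓛 x = length (filter (x ∈?_) 𝓛)
  where open DecMem (_≟F_ {n}) using (_∈?_)

IsLocalDimension : ∀ {n} → Rel n → ℕ → Set
IsLocalDimension {n} R d =
  (∃[ 𝓛 ] IsLocalRealiser R 𝓛 × (∀ x → multiplicity 𝓛 x ≤ d)) ×
  (∀ 𝓛 m → IsLocalRealiser R 𝓛 → (∀ x → multiplicity 𝓛 x ≤ m) → d ≤ m)

{-# OPTIONS --safe #-}

-- The orders of height two with ⌊n/2⌋ minimal and ⌈n/2⌉ maximal elements already give
-- at least 2^(⌊n/2⌋⌈n/2⌉) ≥ 2^((n² − 1)/4) posets on [n].  On the other hand a poset is determined
-- by any local realiser of it, and a local realiser of maximal multiplicity m has total size at
-- most nm: writing its lists one after the other, each entry tagged by whether it ends its list,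
-- gives a word of length at most nm over the 2n letters [n] × Bool.  So at most (2n + 1)^(nm)
-- posets have local dimension at most m, a vanishing fraction when m is a little below
-- n / (4 log n), and Markov's inequality turns this into the bound on the average.

module Submission where

open import Defs
open import Data.Bool using (Bool; true; false; _∨_; not; T; T?)
open import Data.Bool.Properties using (⇔→≡)
open import Data.Empty using (⊥; ⊥-elim)
open import Data.Fin using (Fin; splitAt; _↑ˡ_; _↑ʳ_) renaming (zero to fz; suc to fs; _≟_ to _≟F_)
open import Data.Fin.Properties using (splitAt-↑ˡ; splitAt-↑ʳ)
open import Data.List using (List; []; _∷_; _++_; [_]; map; concatMap; filter; filterᵇ; null; length; allFin; cartesianProduct)
open import Data.List.Properties using (length-++; length-map; length-tabulate; map-cong)
open import Data.List.Membership.Propositional using (_∈_; lose)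
import Data.List.Membership.DecPropositional as DecMembership
open import Data.List.Membership.Propositional.Properties
  using (∈-++⁻; ∈-++⁺ˡ; ∈-++⁺ʳ; ∈-∃++; ∈-map⁺; ∈-map⁻; ∈-filter⁺; ∈-filter⁻; ∈-allFin; ∈-concatMap⁺; ∈-cartesianProduct⁺)
open import Data.List.Relation.Binary.Subset.Propositional using (_⊆_)
open import Data.List.Relation.Unary.All as All using (All; []; _∷_)
import Data.List.Relation.Unary.All.Properties as All
open import Data.List.Relation.Unary.Any using (here; there)
open import Data.List.Relation.Unary.AllPairs as AllPairs using (AllPairs; []; _∷_)
import Data.List.Relation.Unary.AllPairs.Properties as AllPairs
open import Data.List.Relation.Unary.Unique.Propositional using (Unique)
open import Data.Nat using (ℕ; zero; suc; _+_; _*_; _∸_; _^_; _≤_; _<_; _≤?_; z≤n; s≤s; NonZero; >-nonZero; >-nonZero⁻¹; ⌊_/2⌋; ⌈_/2⌉)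
open import Data.Nat.DivMod using (_/_; _%_; m/n*n≤m; m≡m%n+[m/n]*n; m%n<n)
open import Data.Nat.ListAction using (sum)
open import Data.Nat.Properties
open import Data.Nat.Solver using (module +-*-Solver)
open import Data.Product using (∃-syntax; _×_; _,_; proj₁; proj₂)
open import Data.Sum using (_⊎_; inj₁; inj₂)
open import Function using (_∘_; case_of_)
open import Function.Bundles using (mk⇔)
open import Relation.Binary.PropositionalEquality hiding ([_])
open import Relation.Nullary using (Dec; yes; no; does)
open import Relation.Nullary.Decidable using (dec-true; dec-false)
open import Relation.Unary using (Decidable)
open import Algebra.Properties.CommutativeSemigroup +-commutativeSemigroup using (interchange)

open +-*-Solver

module _ {A : Set} where

  unique-⊆⇒length-≤ : {xs ys : List A} → Unique xs → xs ⊆ ys → length xs ≤ length ys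
  unique-⊆⇒length-≤ {[]} _ _ = z≤n
  unique-⊆⇒length-≤ {x ∷ xs} (x∉xs ∷ uniq) xs⊆ys with ∈-∃++ (xs⊆ys (here refl))
  ... | ys₁ , ys₂ , refl = begin
    suc (length xs)               ≤⟨ s≤s (unique-⊆⇒length-≤ uniq xs⊆ys₁++ys₂) ⟩
    suc (length (ys₁ ++ ys₂))     ≡⟨ cong suc (length-++ ys₁) ⟩
    suc (length ys₁ + length ys₂) ≡⟨ +-suc (length ys₁) (length ys₂) ⟨
    length ys₁ + suc (length ys₂) ≡⟨ length-++ ys₁ ⟨
    length (ys₁ ++ x ∷ ys₂)       ∎
    where
    open ≤-Reasoning
    xs⊆ys₁++ys₂ : xs ⊆ ys₁ ++ ys₂
    xs⊆ys₁++ys₂ {z} z∈xs with ∈-++⁻ ys₁ (xs⊆ys (there z∈xs))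
    ... | inj₁ z∈ys₁         = ∈-++⁺ˡ z∈ys₁
    ... | inj₂ (here refl)   = ⊥-elim (All.lookup x∉xs z∈xs refl)
    ... | inj₂ (there z∈ys₂) = ∈-++⁺ʳ ys₁ z∈ys₂

  AllPairs-∩-All : {P : A → Set} {Q : A → A → Set} {xs : List A} →
    All P xs → AllPairs Q xs → AllPairs (λ x y → P x × P y × Q x y) xs
  AllPairs-∩-All []         []           = []
  AllPairs-∩-All (px ∷ pxs) (qx ∷ qxs) =
    All.zipWith (λ (py , qxy) → px , py , qxy) (pxs , qx) ∷ AllPairs-∩-All pxs qxs

module _ {A B : Set} where

  length-≤-injective : (f : A → B) {xs : List A} {ys : List B} →
    AllPairs (λ x x′ → f x ≢ f x′) xs → (∀ {x} → x ∈ xs → f x ∈ ys) → length xs ≤ length ys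
  length-≤-injective f {xs} {ys} injective into = begin
    length xs         ≡⟨ length-map f xs ⟨
    length (map f xs) ≤⟨ unique-⊆⇒length-≤ (AllPairs.map⁺ injective) image⊆ys ⟩
    length ys         ∎
    where
    open ≤-Reasoning
    image⊆ys : map f xs ⊆ ys
    image⊆ys y∈ with ∈-map⁻ f y∈
    ... | x , x∈xs , refl = into x∈xs

  length-concatMap-const : (f : A → List B) (k : ℕ) → (∀ a → length (f a) ≡ k) →
    ∀ as → length (concatMap f as) ≡ length as * k
  length-concatMap-const f k const [] = refl
  length-concatMap-const f k const (a ∷ as) =
    trans (length-++ (f a)) (cong₂ _+_ (const a) (length-concatMap-const f k const as))

  length-cartesianProduct : ∀ (xs : List A) (ys : List B) → length (cartesianProduct xs ys) ≡ length xs * length ys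
  length-cartesianProduct [] ys = refl
  length-cartesianProduct (x ∷ xs) ys =
    trans (length-++ (map (x ,_) ys)) (cong₂ _+_ (length-map (x ,_) ys) (length-cartesianProduct xs ys))

indicator : {P : Set} → Dec P → ℕ
indicator (yes _) = 1
indicator (no _)  = 0

module _ {A : Set} where

  length-filter-∷ : {P : A → Set} (P? : Decidable P) (x : A) (xs : List A) →
    length (filter P? (x ∷ xs)) ≡ indicator (P? x) + length (filter P? xs)
  length-filter-∷ P? x xs with P? x
  ... | yes _ = refl
  ... | no _  = refl

  sum-map-indicator : {P : A → Set} (P? : Decidable P) (xs : List A) →
    sum (map (indicator ∘ P?) xs) ≡ length (filter P? xs)
  sum-map-indicator P? [] = refl
  sum-map-indicator P? (x ∷ xs) =
    trans (cong (indicator (P? x) +_) (sum-map-indicator P? xs)) (sym (length-filter-∷ P? x xs))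

  sum-map-+ : (f g : A → ℕ) (xs : List A) → sum (map (λ x → f x + g x) xs) ≡ sum (map f xs) + sum (map g xs)
  sum-map-+ f g [] = refl
  sum-map-+ f g (x ∷ xs) =
    trans (cong (f x + g x +_) (sum-map-+ f g xs)) (interchange (f x) (g x) (sum (map f xs)) (sum (map g xs)))

  sum-map-zero : (xs : List A) → sum (map (λ _ → 0) xs) ≡ 0
  sum-map-zero [] = refl
  sum-map-zero (x ∷ xs) = sum-map-zero xs

  sum-map-mono : (f g : A → ℕ) (xs : List A) → (∀ {x} → x ∈ xs → f x ≤ g x) → sum (map f xs) ≤ sum (map g xs)
  sum-map-mono f g [] _ = z≤n
  sum-map-mono f g (x ∷ xs) f≤g = +-mono-≤ (f≤g (here refl)) (sum-map-mono f g xs (f≤g ∘ there))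

  sum-map-≤-length* : (f : A → ℕ) (m : ℕ) (xs : List A) → (∀ x → f x ≤ m) → sum (map f xs) ≤ length xs * m
  sum-map-≤-length* f m [] _ = z≤n
  sum-map-≤-length* f m (x ∷ xs) f≤m = +-mono-≤ (f≤m x) (sum-map-≤-length* f m xs f≤m)

  markov : (f : A → ℕ) (m : ℕ) (xs : List A) →
    suc m * length xs ≤ sum (map f xs) + suc m * length (filter (λ x → f x ≤? m) xs)
  markov f m [] = ≤-refl
  markov f m (x ∷ xs) = begin
    suc m * suc (length xs)
      ≡⟨ *-suc (suc m) (length xs) ⟩
    suc m + suc m * length xs
      ≤⟨ +-mono-≤ markov-at-x (markov f m xs) ⟩
    (f x + suc m * indicator (f x ≤? m)) + (sum (map f xs) + suc m * count xs)
      ≡⟨ solve 5 (λ m y i s c → (y :+ (con 1 :+ m) :* i) :+ (s :+ (con 1 :+ m) :* c)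
                              := (y :+ s) :+ (con 1 :+ m) :* (i :+ c))
                 refl m (f x) (indicator (f x ≤? m)) (sum (map f xs)) (count xs) ⟩
    sum (map f (x ∷ xs)) + suc m * (indicator (f x ≤? m) + count xs)
      ≡⟨ cong (λ c → sum (map f (x ∷ xs)) + suc m * c) (length-filter-∷ (λ x → f x ≤? m) x xs) ⟨
    sum (map f (x ∷ xs)) + suc m * count (x ∷ xs) ∎
    where
    open ≤-Reasoning
    count : List A → ℕ
    count ys = length (filter (λ y → f y ≤? m) ys)
    markov-at-x : suc m ≤ f x + suc m * indicator (f x ≤? m)
    markov-at-x with f x ≤? m
    ... | yes _   = ≤-trans (≤-reflexive (sym (*-identityʳ (suc m)))) (m≤n+m _ (f x))
    ... | no fx≰m = ≤-trans (≰⇒> fx≰m) (m≤m+n (f x) _)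

  few-small-values⇒large-sum : (f : A → ℕ) (xs : List A) (m r n K : ℕ) →
    suc r * length (filter (λ x → f x ≤? m) xs) ≤ length xs →
    suc r * n ≤ K * suc m →
    r * n * length xs ≤ K * sum (map f xs)
  few-small-values⇒large-sum f xs m r n K few-small n-small = *-cancelˡ-≤ (suc r) (begin
    suc r * (r * n * C)    ≡⟨ solve 3 (λ r n C → (con 1 :+ r) :* (r :* n :* C) := (con 1 :+ r) :* n :* (r :* C)) refl r n C ⟩
    suc r * n * (r * C)    ≤⟨ *-monoˡ-≤ (r * C) n-small ⟩
    K * suc m * (r * C)    ≡⟨ solve 4 (λ K m r C → K :* (con 1 :+ m) :* (r :* C) := K :* (r :* ((con 1 :+ m) :* C))) refl K m r C ⟩
    K * (r * (suc m * C))  ≤⟨ *-monoʳ-≤ K r[m+1]C≤[r+1]S ⟩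
    K * (suc r * S)        ≡⟨ solve 3 (λ K r S → K :* ((con 1 :+ r) :* S) := (con 1 :+ r) :* (K :* S)) refl K r S ⟩
    suc r * (K * S)        ∎)
    where
    open ≤-Reasoning
    C = length xs
    S = sum (map f xs)
    B = length (filter (λ x → f x ≤? m) xs)
    r[m+1]C≤[r+1]S : r * (suc m * C) ≤ suc r * S
    r[m+1]C≤[r+1]S = +-cancelʳ-≤ (suc m * C) _ _ (begin
      r * (suc m * C) + suc m * C  ≡⟨ +-comm (r * (suc m * C)) (suc m * C) ⟩
      suc r * (suc m * C)          ≤⟨ *-monoʳ-≤ (suc r) (markov f m xs) ⟩
      suc r * (S + suc m * B)      ≡⟨ solve 4 (λ r m S B → (con 1 :+ r) :* (S :+ (con 1 :+ m) :* B)
                                                       := (con 1 :+ r) :* S :+ (con 1 :+ m) :* ((con 1 :+ r) :* B))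
                                               refl r m S B ⟩
      suc r * S + suc m * (suc r * B) ≤⟨ +-monoʳ-≤ (suc r * S) (*-monoʳ-≤ (suc m) few-small) ⟩
      suc r * S + suc m * C        ∎)

module _ {A B : Set} where

  sum-count-swap : {P : A → B → Set} (P? : ∀ a b → Dec (P a b)) (as : List A) (bs : List B) →
    sum (map (λ a → length (filter (P? a) bs)) as) ≡ sum (map (λ b → length (filter (λ a → P? a b) as)) bs)
  sum-count-swap P? [] bs = sym (sum-map-zero bs)
  sum-count-swap P? (a ∷ as) bs = begin
    length (filter (P? a) bs) + sum (map (λ a → length (filter (P? a) bs)) as)
      ≡⟨ cong₂ _+_ (sym (sum-map-indicator (P? a) bs)) (sum-count-swap P? as bs) ⟩
    sum (map (indicator ∘ P? a) bs) + sum (map (λ b → length (filter (λ a → P? a b) as)) bs)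
      ≡⟨ sum-map-+ (indicator ∘ P? a) _ bs ⟨
    sum (map (λ b → indicator (P? a b) + length (filter (λ a → P? a b) as)) bs)
      ≡⟨ cong sum (map-cong (λ b → sym (length-filter-∷ (λ a → P? a b) a as)) bs) ⟩
    sum (map (λ b → length (filter (λ a → P? a b) (a ∷ as))) bs) ∎
    where open ≡-Reasoning

-- Distinctness with a witness: without function extensionality, c ≢ c′ would not yield a point
-- where c and c′ differ.
Apart : {A : Set} → (A → A → Set) → {m : ℕ} → (Fin m → A) → (Fin m → A) → Set
Apart D f g = ∃[ i ] D (f i) (g i)

module _ {A : Set} where

  length-allFuns : (as : List A) (m : ℕ) → length (allFuns as m) ≡ length as ^ m
  length-allFuns as zero = refl
  length-allFuns as (suc m) = length-concatMap-const _ (length as ^ m)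
    (λ a → trans (length-map (consF a) (allFuns as m)) (length-allFuns as m)) as

  allFuns-complete : (as : List A) (m : ℕ) (f : Fin m → A) → (∀ i → f i ∈ as) →
    ∃[ g ] g ∈ allFuns as m × g ≗ f
  allFuns-complete as zero f _ = (λ ()) , here refl , λ ()
  allFuns-complete as (suc m) f f∈as with allFuns-complete as m (f ∘ fs) (f∈as ∘ fs)
  ... | g , g∈ , g≗f∘fs =
    consF (f fz) g ,
    ∈-concatMap⁺ _ (lose (f∈as fz) (∈-map⁺ (consF (f fz)) g∈)) ,
    λ { fz → refl ; (fs i) → g≗f∘fs i }

  allFuns-apart : {D : A → A → Set} (as : List A) (m : ℕ) → AllPairs D as → AllPairs (Apart D) (allFuns as m)
  allFuns-apart as zero _ = [] ∷ []
  allFuns-apart {D} as (suc m) D-as = AllPairs.concat⁺ blocks-apart across-blocks-apart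
    where
    block : A → List (Fin (suc m) → A)
    block a = map (consF a) (allFuns as m)
    blocks-apart : All (AllPairs (Apart D)) (map block as)
    blocks-apart = All.map⁺ (All.universal
      (λ a → AllPairs.map⁺ (AllPairs.map (λ (i , d) → fs i , d) (allFuns-apart as m D-as))) as)
    across-blocks-apart : AllPairs (λ xs ys → All (λ x → All (Apart D x) ys) xs) (map block as)
    across-blocks-apart = AllPairs.map⁺ (AllPairs.map
      (λ d → All.map⁺ (All.universal (λ _ → All.map⁺ (All.universal (λ _ → fz , d) _)) _)) D-as)

bools : List Bool
bools = false ∷ true ∷ []

∈-bools : ∀ b → b ∈ bools
∈-bools false = here refl
∈-bools true  = there (here refl)

bools-apart : AllPairs _≢_ bools
bools-apart = ((λ ()) ∷ []) ∷ [] ∷ []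

_≗₂_ : ∀ {n} → Rel n → Rel n → Set
R ≗₂ R′ = ∀ x y → R x y ≡ R′ x y

allRels-complete : ∀ {n} (R : Rel n) → ∃[ R′ ] R′ ∈ allRels n × R′ ≗₂ R
allRels-complete {n} R =
  let R′ , R′∈ , R′≗rows = allFuns-complete (allFuns bools n) n (proj₁ ∘ row) (proj₁ ∘ proj₂ ∘ row)
  in R′ , R′∈ , λ x y → trans (cong-app (R′≗rows x) y) (proj₂ (proj₂ (row x)) y)
  where
  row : ∀ x → ∃[ g ] g ∈ allFuns bools n × g ≗ R x
  row x = allFuns-complete bools n (R x) (∈-bools ∘ R x)

IsPartialOrder-resp : ∀ {n} {R R′ : Rel n} → R ≗₂ R′ → IsPartialOrder R → IsPartialOrder R′
IsPartialOrder-resp {R = R} {R′} R≗R′ (reflexive , antisym , transitive) =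
  (λ x → to (reflexive x)) ,
  (λ x y x≤y y≤x → antisym x y (from x≤y) (from y≤x)) ,
  (λ x y z x≤y y≤z → to (transitive x y z (from x≤y) (from y≤z)))
  where
  to : ∀ {x y} → x ≤[ R ] y → x ≤[ R′ ] y
  to {x} {y} = trans (sym (R≗R′ x y))
  from : ∀ {x y} → x ≤[ R′ ] y → x ≤[ R ] y
  from {x} {y} = trans (R≗R′ x y)

allPosets-complete : ∀ {n} (R : Rel n) → IsPartialOrder R → ∃[ R′ ] R′ ∈ allPosets n × R′ ≗₂ R
allPosets-complete R R-po =
  let R′ , R′∈ , R′≗R = allRels-complete R
  in R′ , ∈-filter⁺ isPartialOrder? R′∈ (IsPartialOrder-resp (λ x y → sym (R′≗R x y)) R-po) , R′≗R

allPosets-apart : ∀ n → AllPairs (Apart (Apart _≢_)) (allPosets n)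
allPosets-apart n = AllPairs.filter⁺ isPartialOrder? (allFuns-apart _ n (allFuns-apart bools n bools-apart))

-- Bipartite posets

module Bipartite {p k : ℕ} (c : Fin p → Fin k → Bool) where

  below : Fin p ⊎ Fin k → Fin p ⊎ Fin k → Bool
  below (inj₁ i) (inj₂ j) = c i j
  below _        _        = false

  below-no-chain : ∀ s t u → below s t ≡ true → below t u ≡ true → ⊥
  below-no-chain (inj₁ _) (inj₁ _) _ () _
  below-no-chain (inj₁ _) (inj₂ _) _ _ ()
  below-no-chain (inj₂ _) _        _ () _

  bipartite : Rel (p + k)
  bipartite x y = does (x ≟F y) ∨ below (splitAt p x) (splitAt p y)

  bipartite-true : ∀ {x y} → x ≤[ bipartite ] y → x ≡ y ⊎ below (splitAt p x) (splitAt p y) ≡ true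
  bipartite-true {x} {y} x≤y with x ≟F y
  ... | yes x≡y = inj₁ x≡y
  ... | no _    = inj₂ x≤y

  bipartite-isPartialOrder : IsPartialOrder bipartite
  bipartite-isPartialOrder = reflexive , antisym , transitive
    where
    reflexive : ∀ x → x ≤[ bipartite ] x
    reflexive x = cong (_∨ below (splitAt p x) (splitAt p x)) (dec-true (x ≟F x) refl)
    antisym : ∀ x y → x ≤[ bipartite ] y → y ≤[ bipartite ] x → x ≡ y
    antisym x y x≤y y≤x with bipartite-true x≤y | bipartite-true y≤x
    ... | inj₁ x≡y | _        = x≡y
    ... | inj₂ _   | inj₁ y≡x = sym y≡x
    ... | inj₂ x<y | inj₂ y<x = ⊥-elim (below-no-chain (splitAt p x) (splitAt p y) (splitAt p x) x<y y<x)
    transitive : ∀ x y z → x ≤[ bipartite ] y → y ≤[ bipartite ] z → x ≤[ bipartite ] z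
    transitive x y z x≤y y≤z with bipartite-true x≤y | bipartite-true y≤z
    ... | inj₁ refl | _         = y≤z
    ... | inj₂ _    | inj₁ refl = x≤y
    ... | inj₂ x<y  | inj₂ y<z  = ⊥-elim (below-no-chain (splitAt p x) (splitAt p y) (splitAt p z) x<y y<z)

  ↑ˡ≢↑ʳ : ∀ i j → i ↑ˡ k ≢ p ↑ʳ j
  ↑ˡ≢↑ʳ i j eq with trans (sym (splitAt-↑ˡ p i k)) (trans (cong (splitAt p) eq) (splitAt-↑ʳ p k j))
  ... | ()

  bipartite-↑ˡ-↑ʳ : ∀ i j → bipartite (i ↑ˡ k) (p ↑ʳ j) ≡ c i j
  bipartite-↑ˡ-↑ʳ i j
    rewrite dec-false (i ↑ˡ k ≟F p ↑ʳ j) (↑ˡ≢↑ʳ i j) | splitAt-↑ˡ p i k | splitAt-↑ʳ p k j = refl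

numPosets-+-lower : ∀ p k → 2 ^ (k * p) ≤ numPosets (p + k)
numPosets-+-lower p k = let open ≤-Reasoning in begin
  2 ^ (k * p)                          ≡⟨ ^-*-assoc 2 k p ⟨
  (2 ^ k) ^ p                          ≡⟨ cong (_^ p) (length-allFuns bools k) ⟨
  length (allFuns bools k) ^ p         ≡⟨ length-allFuns (allFuns bools k) p ⟨
  length (allFuns (allFuns bools k) p) ≤⟨ length-≤-injective representative
                                            (AllPairs.map representative-apart (allFuns-apart _ p (allFuns-apart bools k bools-apart)))
                                            (λ {c} _ → proj₁ (proj₂ (representation c))) ⟩
  numPosets (p + k)                    ∎
  where
  open Bipartite using (bipartite; bipartite-isPartialOrder; bipartite-↑ˡ-↑ʳ)
  representation : ∀ c → ∃[ R ] R ∈ allPosets (p + k) × R ≗₂ bipartite c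
  representation c = allPosets-complete (bipartite c) (bipartite-isPartialOrder c)
  representative : (Fin p → Fin k → Bool) → Rel (p + k)
  representative c = proj₁ (representation c)
  representative-apart : ∀ {c c′} → Apart (Apart _≢_) c c′ → representative c ≢ representative c′
  representative-apart {c} {c′} (i , j , cij≢c′ij) eq = cij≢c′ij (begin
    c i j                                   ≡⟨ bipartite-↑ˡ-↑ʳ c i j ⟨
    bipartite c (i ↑ˡ k) (p ↑ʳ j)           ≡⟨ proj₂ (proj₂ (representation c)) _ _ ⟨
    representative c (i ↑ˡ k) (p ↑ʳ j)      ≡⟨ cong (λ R → R (i ↑ˡ k) (p ↑ʳ j)) eq ⟩
    representative c′ (i ↑ˡ k) (p ↑ʳ j)     ≡⟨ proj₂ (proj₂ (representation c′)) _ _ ⟩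
    bipartite c′ (i ↑ˡ k) (p ↑ʳ j)          ≡⟨ bipartite-↑ˡ-↑ʳ c′ i j ⟩
    c′ i j                                  ∎)
    where open ≡-Reasoning

numPosets-lower : ∀ n → 2 ^ (⌈ n /2⌉ * ⌊ n /2⌋) ≤ numPosets n
numPosets-lower n =
  subst (λ m → 2 ^ (⌈ n /2⌉ * ⌊ n /2⌋) ≤ numPosets m) (⌊n/2⌋+⌈n/2⌉≡n n) (numPosets-+-lower ⌊ n /2⌋ ⌈ n /2⌉)

n*n≤4*⌈n/2⌉*⌊n/2⌋+1 : ∀ n → n * n ≤ 4 * (⌈ n /2⌉ * ⌊ n /2⌋) + 1
n*n≤4*⌈n/2⌉*⌊n/2⌋+1 zero = z≤n
n*n≤4*⌈n/2⌉*⌊n/2⌋+1 (suc zero) = ≤-refl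
n*n≤4*⌈n/2⌉*⌊n/2⌋+1 (suc (suc n)) = begin
  (2 + n) * (2 + n)                    ≡⟨ solve 1 (λ n → (con 2 :+ n) :* (con 2 :+ n) := n :* n :+ (con 4 :* n :+ con 4)) refl n ⟩
  n * n + (4 * n + 4)                  ≤⟨ +-monoˡ-≤ _ (n*n≤4*⌈n/2⌉*⌊n/2⌋+1 n) ⟩
  4 * (u * d) + 1 + (4 * n + 4)        ≡⟨ cong (λ m → 4 * (u * d) + 1 + (4 * m + 4)) (⌊n/2⌋+⌈n/2⌉≡n n) ⟨
  4 * (u * d) + 1 + (4 * (d + u) + 4)  ≡⟨ solve 2 (λ u d → con 4 :* (u :* d) :+ con 1 :+ (con 4 :* (d :+ u) :+ con 4)
                                                       := con 4 :* ((con 1 :+ u) :* (con 1 :+ d)) :+ con 1) refl u d ⟩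
  4 * (suc u * suc d) + 1              ∎
  where
  open ≤-Reasoning
  u = ⌈ n /2⌉
  d = ⌊ n /2⌋

-- Local realisers determine the order

_⊆⁺_ : {A : Set} → List (List A) → List (List A) → Set
𝓛 ⊆⁺ 𝓛′ = ∀ {L z} → L ∈ 𝓛 → z ∈ L → L ∈ 𝓛′

module _ {n : ℕ} where

  Before-∷ : ∀ {z x y : Fin n} {L} → Before (z ∷ L) x y → x ≡ z ⊎ Before L x y
  Before-∷ ([]      , _   , refl , _)  = inj₁ refl
  Before-∷ (_ ∷ pre , suf , refl , y∈) = inj₂ (pre , suf , refl , y∈)

  Before⇒∈ˡ : ∀ {x y : Fin n} {L} → Before L x y → x ∈ L
  Before⇒∈ˡ (pre , _ , refl , _) = ∈-++⁺ʳ pre (here refl)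

  Before⇒∈ʳ : ∀ {x y : Fin n} {L} → Before L x y → y ∈ L
  Before⇒∈ʳ (pre , _ , refl , y∈) = ∈-++⁺ʳ pre y∈

  Before-antisym : ∀ {x y : Fin n} L → Unique L → Before L x y → Before L y x → x ≡ y
  Before-antisym [] _ x≺y _ with () ← Before⇒∈ˡ x≺y
  Before-antisym (z ∷ L) (z∉L ∷ L-unique) x≺y y≺x with Before-∷ x≺y | Before-∷ y≺x
  ... | inj₁ x≡z | inj₁ y≡z = trans x≡z (sym y≡z)
  ... | inj₁ refl | inj₂ y≺′x = ⊥-elim (All.lookup z∉L (Before⇒∈ʳ y≺′x) refl)
  ... | inj₂ x≺′y | inj₁ refl = ⊥-elim (All.lookup z∉L (Before⇒∈ʳ x≺′y) refl)
  ... | inj₂ x≺′y | inj₂ y≺′x = Before-antisym L L-unique x≺′y y≺′x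

  -- If x ≤ y but not x ≤′ y, some list of 𝓛′ puts y before x; being in 𝓛, it also puts x before y.
  realiser-⊆⁺⇒order-⊆ : {R R′ : Rel n} {𝓛 𝓛′ : List (List (Fin n))} → (∀ x → x ≤[ R′ ] x) →
    IsLocalRealiser R 𝓛 → IsLocalRealiser R′ 𝓛′ → 𝓛′ ⊆⁺ 𝓛 → ∀ x y → x ≤[ R ] y → x ≤[ R′ ] y
  realiser-⊆⁺⇒order-⊆ {R′ = R′} reflexive′ (extensions , _) (_ , realises′) 𝓛′⊆⁺𝓛 x y x≤y
    with R′ x y in x≰′y
  ... | true = refl
  ... | false with realises′ y x (λ x≤′y → case trans (sym x≰′y) x≤′y of λ ())
  ... | L , L∈𝓛′ , y∈L , x∈L , y≺x with extensions L (𝓛′⊆⁺𝓛 L∈𝓛′ x∈L)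
  ... | L-unique , L-extends with Before-antisym L L-unique (L-extends x y x∈L y∈L x≤y) y≺x
  ... | refl = trans (sym x≰′y) (reflexive′ x)

  realisers-determine : {R R′ : Rel n} {𝓛 𝓛′ : List (List (Fin n))} → IsPartialOrder R → IsPartialOrder R′ →
    IsLocalRealiser R 𝓛 → IsLocalRealiser R′ 𝓛′ → 𝓛 ⊆⁺ 𝓛′ → 𝓛′ ⊆⁺ 𝓛 → R ≗₂ R′
  realisers-determine (reflexive , _) (reflexive′ , _) realiser realiser′ 𝓛⊆⁺𝓛′ 𝓛′⊆⁺𝓛 x y = ⇔→≡ (mk⇔
    (realiser-⊆⁺⇒order-⊆ reflexive′ realiser realiser′ 𝓛′⊆⁺𝓛 x y)
    (realiser-⊆⁺⇒order-⊆ reflexive realiser′ realiser 𝓛⊆⁺𝓛′ x y))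

-- Encoding local realisers as words

module _ {A : Set} where

  markLast : List A → List (A × Bool)
  markLast []           = []
  markLast (x ∷ [])     = (x , true) ∷ []
  markLast (x ∷ y ∷ xs) = (x , false) ∷ markLast (y ∷ xs)

  flatten : List (List A) → List (A × Bool)
  flatten = concatMap markLast

  prepend : A → List (List A) → List (List A)
  prepend x []       = [ x ] ∷ []
  prepend x (L ∷ Ls) = (x ∷ L) ∷ Ls

  unflatten : List (A × Bool) → List (List A)
  unflatten []               = []
  unflatten ((x , true) ∷ w)  = [ x ] ∷ unflatten w
  unflatten ((x , false) ∷ w) = prepend x (unflatten w)

  unflatten-markLast-++ : ∀ x L w → unflatten (markLast (x ∷ L) ++ w) ≡ (x ∷ L) ∷ unflatten w
  unflatten-markLast-++ x []      w = refl
  unflatten-markLast-++ x (y ∷ L) w rewrite unflatten-markLast-++ y L w = refl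

  unflatten-flatten : ∀ Ls → unflatten (flatten Ls) ≡ filterᵇ (not ∘ null) Ls
  unflatten-flatten []             = refl
  unflatten-flatten ([] ∷ Ls)      = unflatten-flatten Ls
  unflatten-flatten ((x ∷ L) ∷ Ls) =
    trans (unflatten-markLast-++ x L (flatten Ls)) (cong ((x ∷ L) ∷_) (unflatten-flatten Ls))

  flatten-≡⇒⊆⁺ : ∀ {Ls Ls′} → flatten Ls ≡ flatten Ls′ → Ls′ ⊆⁺ Ls
  flatten-≡⇒⊆⁺ {Ls} {Ls′} eq {L} L∈Ls′ z∈L =
    proj₁ (∈-filter⁻ nonEmpty? (subst (L ∈_) same-nonempty-members (∈-filter⁺ nonEmpty? L∈Ls′ (nonEmpty z∈L))))
    where
    nonEmpty? = T? ∘ not ∘ null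
    nonEmpty : ∀ {z : A} {L} → z ∈ L → T (not (null L))
    nonEmpty (here _)  = _
    nonEmpty (there _) = _
    same-nonempty-members : filterᵇ (not ∘ null) Ls′ ≡ filterᵇ (not ∘ null) Ls
    same-nonempty-members = trans (sym (unflatten-flatten Ls′)) (trans (cong unflatten (sym eq)) (unflatten-flatten Ls))

  length-markLast : ∀ L → length (markLast L) ≡ length L
  length-markLast []          = refl
  length-markLast (x ∷ [])    = refl
  length-markLast (x ∷ y ∷ L) = cong suc (length-markLast (y ∷ L))

  length-flatten : ∀ Ls → length (flatten Ls) ≡ sum (map length Ls)
  length-flatten []       = refl
  length-flatten (L ∷ Ls) = trans (length-++ (markLast L)) (cong₂ _+_ (length-markLast L) (length-flatten Ls))

  listsOfLength≤ : List A → ℕ → List (List A)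
  listsOfLength≤ as zero    = [ [] ]
  listsOfLength≤ as (suc T) = [] ∷ concatMap (λ a → map (a ∷_) (listsOfLength≤ as T)) as

  ∈-listsOfLength≤ : ∀ as T {xs} → length xs ≤ T → xs ⊆ as → xs ∈ listsOfLength≤ as T
  ∈-listsOfLength≤ as zero    {[]}     _         _     = here refl
  ∈-listsOfLength≤ as (suc T) {[]}     _         _     = here refl
  ∈-listsOfLength≤ as (suc T) {x ∷ xs} (s≤s |xs|≤T) xs⊆as =
    there (∈-concatMap⁺ _ (lose (xs⊆as (here refl)) (∈-map⁺ (x ∷_) (∈-listsOfLength≤ as T |xs|≤T (xs⊆as ∘ there)))))

  length-listsOfLength≤ : ∀ as T → length (listsOfLength≤ as T) ≤ suc (length as) ^ T
  length-listsOfLength≤ as zero    = ≤-refl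
  length-listsOfLength≤ as (suc T) = begin
    suc (length (concatMap (λ a → map (a ∷_) (listsOfLength≤ as T)) as))
      ≡⟨ cong suc (length-concatMap-const _ _ (λ a → length-map (a ∷_) (listsOfLength≤ as T)) as) ⟩
    suc (length as * length (listsOfLength≤ as T))
      ≤⟨ +-mono-≤ (m^n>0 (suc (length as)) T) (*-monoʳ-≤ (length as) (length-listsOfLength≤ as T)) ⟩
    suc (length as) ^ T + length as * suc (length as) ^ T
      ≡⟨⟩
    suc (length as) ^ suc T ∎
    where open ≤-Reasoning

-- Posets of small local dimension

sum-length≤sum-multiplicity : ∀ {n} (𝓛 : List (List (Fin n))) → All Unique 𝓛 →
  sum (map length 𝓛) ≤ sum (map (multiplicity 𝓛) (allFin n))
sum-length≤sum-multiplicity {n} 𝓛 𝓛-unique = begin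
  sum (map length 𝓛)                                   ≤⟨ sum-map-mono _ _ 𝓛 length≤count ⟩
  sum (map (λ L → length (filter (_∈? L) (allFin n))) 𝓛) ≡⟨ sum-count-swap (λ x L → x ∈? L) (allFin n) 𝓛 ⟨
  sum (map (multiplicity 𝓛) (allFin n))                ∎
  where
  open ≤-Reasoning
  open DecMembership (_≟F_ {n}) using (_∈?_)
  length≤count : ∀ {L} → L ∈ 𝓛 → length L ≤ length (filter (_∈? L) (allFin n))
  length≤count {L} L∈𝓛 =
    unique-⊆⇒length-≤ (All.lookup 𝓛-unique L∈𝓛) (λ {x} x∈L → ∈-filter⁺ (_∈? L) (∈-allFin x) x∈L)

module SmallLocalDimension {n : ℕ} (ldim : Rel n → ℕ)
  (ldim-spec : ∀ R → IsPartialOrder R → IsLocalDimension R (ldim R)) where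

  -- Taking the decision as an argument makes code below a function on all relations.
  realiser : (R : Rel n) → Dec (IsPartialOrder R) → List (List (Fin n))
  realiser R (yes R-po) = proj₁ (proj₁ (ldim-spec R R-po))
  realiser R (no _)     = []

  realiser-spec : ∀ {R} → IsPartialOrder R → (R-po? : Dec (IsPartialOrder R)) →
    IsLocalRealiser R (realiser R R-po?) × (∀ x → multiplicity (realiser R R-po?) x ≤ ldim R)
  realiser-spec _    (yes R-po) = proj₂ (proj₁ (ldim-spec _ R-po))
  realiser-spec R-po (no ¬R-po) = ⊥-elim (¬R-po R-po)

  code : Rel n → List (Fin n × Bool)
  code R = flatten (realiser R (isPartialOrder? R))

  length-code : ∀ {R} → IsPartialOrder R → length (code R) ≤ n * ldim R
  length-code {R} R-po = begin
    length (code R)                    ≡⟨ length-flatten 𝓛 ⟩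
    sum (map length 𝓛)                 ≤⟨ sum-length≤sum-multiplicity 𝓛 (All.tabulate (λ L∈𝓛 → proj₁ (extension L∈𝓛))) ⟩
    sum (map (multiplicity 𝓛) (allFin n)) ≤⟨ sum-map-≤-length* (multiplicity 𝓛) (ldim R) (allFin n) (proj₂ spec) ⟩
    length (allFin n) * ldim R         ≡⟨ cong (_* ldim R) (length-tabulate {n = n} (λ x → x)) ⟩
    n * ldim R                         ∎
    where
    open ≤-Reasoning
    𝓛 = realiser R (isPartialOrder? R)
    spec = realiser-spec R-po (isPartialOrder? R)
    extension : ∀ {L} → L ∈ 𝓛 → IsPartialLinearExtension R L
    extension = proj₁ (proj₁ spec) _

  code-injective : ∀ {R R′} → IsPartialOrder R → IsPartialOrder R′ → code R ≡ code R′ → R ≗₂ R′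
  code-injective {R} {R′} R-po R′-po eq = realisers-determine R-po R′-po
    (proj₁ (realiser-spec R-po (isPartialOrder? R))) (proj₁ (realiser-spec R′-po (isPartialOrder? R′)))
    (flatten-≡⇒⊆⁺ (sym eq)) (flatten-≡⇒⊆⁺ eq)

  alphabet : List (Fin n × Bool)
  alphabet = cartesianProduct (allFin n) bools

  length-alphabet : length alphabet ≡ n * 2
  length-alphabet = trans (length-cartesianProduct (allFin n) bools) (cong (_* 2) (length-tabulate {n = n} (λ x → x)))

  length-filter-ldim≤ : ∀ m → length (filter (λ R → ldim R ≤? m) (allPosets n)) ≤ suc (n * 2) ^ (n * m)
  length-filter-ldim≤ m = begin
    length small                                  ≤⟨ length-≤-injective code code-apart code∈ ⟩
    length (listsOfLength≤ alphabet (n * m))      ≤⟨ length-listsOfLength≤ alphabet (n * m) ⟩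
    suc (length alphabet) ^ (n * m)               ≡⟨ cong (λ a → suc a ^ (n * m)) length-alphabet ⟩
    suc (n * 2) ^ (n * m)                         ∎
    where
    open ≤-Reasoning
    small = filter (λ R → ldim R ≤? m) (allPosets n)
    ∈-small⁻ : ∀ {R} → R ∈ small → IsPartialOrder R × ldim R ≤ m
    ∈-small⁻ R∈ =
      let R∈posets , ldim≤m = ∈-filter⁻ (λ R → ldim R ≤? m) {xs = allPosets n} R∈
      in proj₂ (∈-filter⁻ isPartialOrder? {xs = allRels n} R∈posets) , ldim≤m
    code-apart : AllPairs (λ R R′ → code R ≢ code R′) small
    code-apart = AllPairs.map (λ { (R-po , R′-po , (x , y , Rxy≢R′xy)) eq → Rxy≢R′xy (code-injective R-po R′-po eq x y) })
      (AllPairs-∩-All (All.tabulate (proj₁ ∘ ∈-small⁻)) (AllPairs.filter⁺ (λ R → ldim R ≤? m) (allPosets-apart n)))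
    code∈ : ∀ {R} → R ∈ small → code R ∈ listsOfLength≤ alphabet (n * m)
    code∈ R∈ = ∈-listsOfLength≤ alphabet (n * m)
      (≤-trans (length-code (proj₁ (∈-small⁻ R∈))) (*-monoʳ-≤ n (proj₂ (∈-small⁻ R∈))))
      (λ { {x , b} _ → ∈-cartesianProduct⁺ (∈-allFin x) (∈-bools b) })

-- Choice of parameters

1+n≤2^n : ∀ n → suc n ≤ 2 ^ n
1+n≤2^n zero    = ≤-refl
1+n≤2^n (suc n) = +-mono-≤ (m^n>0 2 n) (≤-trans (1+n≤2^n n) (m≤m+n (2 ^ n) 0))

2^m<2^n⇒m<n : ∀ {m n} → 2 ^ m < 2 ^ n → m < n
2^m<2^n⇒m<n 2^m<2^n = ≰⇒> (λ n≤m → <⇒≱ 2^m<2^n (^-monoʳ-≤ 2 n≤m))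

∃⌊log₂⌋ : ∀ n .{{_ : NonZero n}} → ∃[ ℓ ] 2 ^ ℓ ≤ n × n < 2 ^ suc ℓ
∃⌊log₂⌋ (suc zero) = 0 , ≤-refl , s≤s (s≤s z≤n)
∃⌊log₂⌋ (suc (suc n)) with ∃⌊log₂⌋ (suc n)
... | ℓ , 2^ℓ≤1+n , 1+n<2^[1+ℓ] with m≤n⇒m<n∨m≡n 1+n<2^[1+ℓ]
...   | inj₁ 2+n<2^[1+ℓ] = ℓ , m≤n⇒m≤1+n 2^ℓ≤1+n , 2+n<2^[1+ℓ]
...   | inj₂ 2+n≡2^[1+ℓ] = suc ℓ , ≤-reflexive (sym 2+n≡2^[1+ℓ]) ,
        subst (_< 2 ^ suc (suc ℓ)) (sym 2+n≡2^[1+ℓ]) (^-monoʳ-< 2 (s≤s (s≤s z≤n)) (n<1+n (suc ℓ)))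

m<[1+m/n]*n : ∀ m n .{{_ : NonZero n}} → m < suc (m / n) * n
m<[1+m/n]*n m n = begin-strict
  m                 ≡⟨ m≡m%n+[m/n]*n m n ⟩
  m % n + m / n * n <⟨ +-monoˡ-< (m / n * n) (m%n<n m n) ⟩
  suc (m / n) * n   ∎
  where open ≤-Reasoning

module Asymptotics (a r : ℕ) .{{a≢0 : NonZero a}} where

  b : ℕ
  b = 4 * a + r

  4b≢0 : NonZero (4 * b)
  4b≢0 = >-nonZero (≤-trans (>-nonZero⁻¹ a) (≤-trans (m≤n*m a 4) (≤-trans (m≤m+n (4 * a) r) (m≤n*m b 4))))

  threshold : ℕ
  threshold = 2 ^ (2 * r + 2) + b * (4 * r + 1)

  r+[2+ℓ]*n*m≤u*d : ∀ {ℓ n m u d} → m * (4 * b * (2 + ℓ)) ≤ n * (2 * a + r) → b * (4 * r + 1) ≤ n * n →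
    n * n ≤ 4 * (u * d) + 1 → r + (2 + ℓ) * (n * m) ≤ u * d
  r+[2+ℓ]*n*m≤u*d {ℓ} {n} {m} {u} {d} mD≤n[2a+r] n-large n*n≤4ud+1 =
    *-cancelˡ-≤ (4 * b) {{4b≢0}} (+-cancelʳ-≤ b _ _ (begin
    4 * b * (r + (2 + ℓ) * (n * m)) + b
      ≡⟨ solve 5 (λ r ℓ n m b → con 4 :* b :* (r :+ (con 2 :+ ℓ) :* (n :* m)) :+ b
                              := b :* (con 4 :* r :+ con 1) :+ n :* (m :* (con 4 :* b :* (con 2 :+ ℓ))))
                 refl r ℓ n m b ⟩
    b * (4 * r + 1) + n * (m * (4 * b * (2 + ℓ)))
      ≤⟨ +-mono-≤ (≤-trans n-large (m≤n*m (n * n) (2 * a) {{m*n≢0 2 a}})) (*-monoʳ-≤ n mD≤n[2a+r]) ⟩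
    2 * a * (n * n) + n * (n * (2 * a + r))
      ≡⟨ solve 3 (λ a r n → con 2 :* a :* (n :* n) :+ n :* (n :* (con 2 :* a :+ r)) := (con 4 :* a :+ r) :* (n :* n))
                 refl a r n ⟩
    b * (n * n)
      ≤⟨ *-monoʳ-≤ b n*n≤4ud+1 ⟩
    b * (4 * (u * d) + 1)
      ≡⟨ solve 2 (λ b e → b :* (con 4 :* e :+ con 1) := con 4 :* b :* e :+ b) refl b (u * d) ⟩
    4 * b * (u * d) + b ∎))
    where open ≤-Reasoning

  [1+r]*n≤ℓ*4b*[1+m] : ∀ {ℓ n m} → 2 * r + 2 ≤ ℓ → n * (2 * a + r) < suc m * (4 * b * (2 + ℓ)) →
    suc r * n ≤ ℓ * (4 * b) * suc m
  [1+r]*n≤ℓ*4b*[1+m] {ℓ} {n} {m} ℓ-large n[2a+r]<[1+m]D = *-cancelˡ-≤ (2 + ℓ) (begin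
    (2 + ℓ) * (suc r * n)
      ≡⟨ solve 3 (λ r ℓ n → (con 2 :+ ℓ) :* ((con 1 :+ r) :* n) := n :* ((con 1 :+ r) :* (con 2 :+ ℓ))) refl r ℓ n ⟩
    n * (suc r * (2 + ℓ))
      ≤⟨ *-monoʳ-≤ n [1+r][2+ℓ]≤[2a+r]ℓ ⟩
    n * ((2 * a + r) * ℓ)
      ≡⟨ solve 4 (λ a r ℓ n → n :* ((con 2 :* a :+ r) :* ℓ) := ℓ :* (n :* (con 2 :* a :+ r))) refl a r ℓ n ⟩
    ℓ * (n * (2 * a + r))
      ≤⟨ *-monoʳ-≤ ℓ (<⇒≤ n[2a+r]<[1+m]D) ⟩
    ℓ * (suc m * (4 * b * (2 + ℓ)))
      ≡⟨ solve 3 (λ ℓ m b → ℓ :* ((con 1 :+ m) :* (con 4 :* b :* (con 2 :+ ℓ)))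
                          := (con 2 :+ ℓ) :* (ℓ :* (con 4 :* b) :* (con 1 :+ m))) refl ℓ m b ⟩
    (2 + ℓ) * (ℓ * (4 * b) * suc m) ∎)
    where
    open ≤-Reasoning
    [1+r][2+ℓ]≤[2a+r]ℓ : suc r * (2 + ℓ) ≤ (2 * a + r) * ℓ
    [1+r][2+ℓ]≤[2a+r]ℓ = begin
      suc r * (2 + ℓ)
        ≡⟨ solve 2 (λ r ℓ → (con 1 :+ r) :* (con 2 :+ ℓ) := r :* ℓ :+ (ℓ :+ (con 2 :* r :+ con 2))) refl r ℓ ⟩
      r * ℓ + (ℓ + (2 * r + 2))
        ≤⟨ +-monoʳ-≤ (r * ℓ) (+-monoʳ-≤ ℓ ℓ-large) ⟩
      r * ℓ + (ℓ + ℓ)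
        ≡⟨ solve 2 (λ r ℓ → r :* ℓ :+ (ℓ :+ ℓ) := r :* ℓ :+ con 2 :* ℓ) refl r ℓ ⟩
      r * ℓ + 2 * ℓ
        ≤⟨ +-monoʳ-≤ (r * ℓ) (*-monoˡ-≤ ℓ (*-monoʳ-≤ 2 (>-nonZero⁻¹ a))) ⟩
      r * ℓ + 2 * a * ℓ
        ≡⟨ solve 3 (λ a r ℓ → r :* ℓ :+ con 2 :* a :* ℓ := (con 2 :* a :+ r) :* ℓ) refl a r ℓ ⟩
      (2 * a + r) * ℓ ∎

  few-posets-of-small-ldim : ∀ {n ℓ m} (ldim : Rel n → ℕ) → (∀ R → IsPartialOrder R → IsLocalDimension R (ldim R)) →
    n < 2 ^ suc ℓ → m * (4 * b * (2 + ℓ)) ≤ n * (2 * a + r) → b * (4 * r + 1) ≤ n * n →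
    suc r * length (filter (λ R → ldim R ≤? m) (allPosets n)) ≤ numPosets n
  few-posets-of-small-ldim {n} {ℓ} {m} ldim ldim-spec n<2^[1+ℓ] mD≤n[2a+r] n-large = begin
    suc r * length (filter (λ R → ldim R ≤? m) (allPosets n))
      ≤⟨ *-mono-≤ (1+n≤2^n r) (SmallLocalDimension.length-filter-ldim≤ ldim ldim-spec m) ⟩
    2 ^ r * suc (n * 2) ^ (n * m)
      ≤⟨ *-monoʳ-≤ (2 ^ r) (^-monoˡ-≤ (n * m) 1+2n≤2^[2+ℓ]) ⟩
    2 ^ r * (2 ^ (2 + ℓ)) ^ (n * m)
      ≡⟨ cong (2 ^ r *_) (^-*-assoc 2 (2 + ℓ) (n * m)) ⟩
    2 ^ r * 2 ^ ((2 + ℓ) * (n * m))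
      ≡⟨ ^-distribˡ-+-* 2 r _ ⟨
    2 ^ (r + (2 + ℓ) * (n * m))
      ≤⟨ ^-monoʳ-≤ 2 (r+[2+ℓ]*n*m≤u*d {ℓ} {n} {m} {⌈ n /2⌉} {⌊ n /2⌋}
                       mD≤n[2a+r] n-large (n*n≤4*⌈n/2⌉*⌊n/2⌋+1 n)) ⟩
    2 ^ (⌈ n /2⌉ * ⌊ n /2⌋)
      ≤⟨ numPosets-lower n ⟩
    numPosets n ∎
    where
    open ≤-Reasoning
    1+2n≤2^[2+ℓ] : suc (n * 2) ≤ 2 ^ (2 + ℓ)
    1+2n≤2^[2+ℓ] = ≤-trans (n≤1+n _)
      (≤-trans (≤-reflexive (solve 1 (λ n → con 2 :+ n :* con 2 := con 2 :* (con 1 :+ n)) refl n)) (*-monoʳ-≤ 2 n<2^[1+ℓ]))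

  average-ldim-bound : ∀ {n ℓ} → threshold ≤ n → n < 2 ^ suc ℓ →
    (ldim : Rel n → ℕ) → (∀ R → IsPartialOrder R → IsLocalDimension R (ldim R)) →
    r * n * numPosets n ≤ ℓ * (4 * b * sumOverPosets n ldim)
  average-ldim-bound {n} {ℓ} n≥threshold n<2^[1+ℓ] ldim ldim-spec =
    subst (r * n * numPosets n ≤_) (*-assoc ℓ (4 * b) _)
      (few-small-values⇒large-sum ldim (allPosets n) m r n (ℓ * (4 * b))
        (few-posets-of-small-ldim {ℓ = ℓ} {m} ldim ldim-spec n<2^[1+ℓ] (m/n*n≤m (n * (2 * a + r)) D) n-large)
        ([1+r]*n≤ℓ*4b*[1+m] {ℓ} {n} {m} ℓ-large (m<[1+m/n]*n (n * (2 * a + r)) D)))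
    where
    instance
      D≢0 : NonZero (4 * b * (2 + ℓ))
      D≢0 = m*n≢0 (4 * b) (2 + ℓ) {{4b≢0}}
    D = 4 * b * (2 + ℓ)
    -- m ≈ (2a + r) n / (4b log n): as 2a + r < b, posets of local dimension ≤ m are rare, and as
    -- (2a + r) ℓ ≥ (r + 1)(ℓ + 2) once ℓ ≥ 2r + 2, still 4bℓ (m + 1) ≥ (r + 1) n.
    m = n * (2 * a + r) / D
    2^[2r+2]≤n : 2 ^ (2 * r + 2) ≤ n
    2^[2r+2]≤n = ≤-trans (m≤m+n _ _) n≥threshold
    ℓ-large : 2 * r + 2 ≤ ℓ
    ℓ-large = ≤-pred (2^m<2^n⇒m<n (≤-<-trans 2^[2r+2]≤n n<2^[1+ℓ]))
    n-large : b * (4 * r + 1) ≤ n * n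
    n-large = ≤-trans (≤-trans (m≤n+m _ _) n≥threshold)
      (m≤m*n n n {{>-nonZero (≤-trans (m^n>0 2 (2 * r + 2)) 2^[2r+2]≤n)}})

  average-ldim-bound-log₂ : ∀ {n} → threshold ≤ n →
    (ldim : Rel n → ℕ) → (∀ R → IsPartialOrder R → IsLocalDimension R (ldim R)) →
    2 ^ (r * n * numPosets n) ≤ n ^ (4 * b * sumOverPosets n ldim)
  average-ldim-bound-log₂ {n} n≥threshold ldim ldim-spec =
    let instance
          n≢0 : NonZero n
          n≢0 = >-nonZero (≤-trans (m^n>0 2 (2 * r + 2)) (≤-trans (m≤m+n _ _) n≥threshold))
        ℓ , 2^ℓ≤n , n<2^[1+ℓ] = ∃⌊log₂⌋ n
        open ≤-Reasoning
    in begin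
    2 ^ (r * n * numPosets n)
      ≤⟨ ^-monoʳ-≤ 2 (average-ldim-bound {ℓ = ℓ} n≥threshold n<2^[1+ℓ] ldim ldim-spec) ⟩
    2 ^ (ℓ * (4 * b * sumOverPosets n ldim))
      ≡⟨ ^-*-assoc 2 ℓ _ ⟨
    (2 ^ ℓ) ^ (4 * b * sumOverPosets n ldim)
      ≤⟨ ^-monoˡ-≤ (4 * b * sumOverPosets n ldim) 2^ℓ≤n ⟩
    n ^ (4 * b * sumOverPosets n ldim) ∎

theorem4 : (a b : ℕ) → 0 < a → 0 < b →
    ∃[ N ] ((n : ℕ) → N ≤ n → (ldim : Rel n → ℕ) →
      ((R : Rel n) → IsPartialOrder R → IsLocalDimension R (ldim R)) →
      2 ^ ((b ∸ 4 * a) * n * numPosets n) ≤ n ^ (4 * b * sumOverPosets n ldim))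
theorem4 a b 0<a _ with b ≤? 4 * a
... | yes b≤4a = 1 , λ n 1≤n ldim _ →
  subst (λ c → 2 ^ (c * n * numPosets n) ≤ n ^ (4 * b * sumOverPosets n ldim)) (sym (m≤n⇒m∸n≡0 b≤4a))
    (m^n>0 n {{>-nonZero 1≤n}} (4 * b * sumOverPosets n ldim))
... | no b≰4a = threshold , λ n n≥threshold ldim ldim-spec →
  subst (λ c → 2 ^ ((b ∸ 4 * a) * n * numPosets n) ≤ n ^ (4 * c * sumOverPosets n ldim))
    (m+[n∸m]≡n (<⇒≤ (≰⇒> b≰4a))) (average-ldim-bound-log₂ n≥threshold ldim ldim-spec)
  where open Asymptotics a (b ∸ 4 * a) {{>-nonZero 0<a}} using (threshold; average-ldim-bound-log₂)
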